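{- Let $\mathcal A,\mathcal B$ be uniform automata over $\Gamma$ and let $\mathcal M$ be a deterministic Mealy machine from $\Sigma$ to $\Gamma$. Then $\mathcal A[\mathcal M]\times\mathcal B[\mathcal M]$ is isomorphic to $(\mathcal A\times\mathcal B)[\mathcal M]$ in $\mathbf{Aut}_\Sigma$.
   Context: An alphabet is a finite nonempty set. A deterministic Mealy machine $\mathcal M=(Q_{\mathcal M},q_{0,\mathcal M},\partial_{\mathcal M})$ from $\Sigma$ to $\Gamma$ has $\partial_{\mathcal M}:Q_{\mathcal M}\times\Sigma\to Q_{\mathcal M}\times\Gamma$ and induces $F_{\mathcal M}:\Sigma^\omega\to\Gamma^\omega$ (the $n$-th output is the output on the $n$-th letter from the state reached after the first $n$ letters); such functions are called finite-state synchronous. A uniform automaton over $\Gamma$ is $\mathcal A=(Q_{\mathcal A},q_{0,\mathcal A},M(\mathcal A),\partial_{\mathcal A},\Omega_{\mathcal A})$ with $Q_{\mathcal A}$ finite, $M(\mathcal A)$ finite nonempty moves, $\partial_{\mathcal A}:Q_{\mathcal A}\times\Gamma\times M(\mathcal A)\to Q_{\mathcal A}$, $\Omega_{\mathcal A}$ $\omega$-regular; $R\Vdash\mathcal A(\sigma)$ if the state sequence $q_{k+1}=\partial_{\mathcal A}(q_k,\sigma(k),R(k))$ lies in $\Omega_{\mathcal A}$. Product $\mathcal A\times\mathcal B$: states $Q_{\mathcal A}\times Q_{\mathcal B}$, moves $M(\mathcal A)\times M(\mathcal B)$, componentwise transitions on the same letter, accepting iff both components are accepting. Substitution $\mathcal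 A[\mathcal M]$ over $\Sigma$: states $Q_{\mathcal A}\times Q_{\mathcal M}$, initial $(q_{0,\mathcal A},q_{0,\mathcal M})$, moves $M(\mathcal A)$, transitions $((q,p),a,m)\mapsto(\partial_{\mathcal A}(q,b,m),p')$ with $(p',b)=\partial_{\mathcal M}(p,a)$, accepting iff the $Q_{\mathcal A}$-component sequence is in $\Omega_{\mathcal A}$. $\mathbf{Aut}_\Sigma$ has uniform automata over $\Sigma$ as objects and, as morphisms $\mathcal C\to\mathcal D$, finite-state synchronous $F:(\Sigma\times M(\mathcal C))^\omega\to M(\mathcal D)^\omega$ with $F(\sigma,R)\Vdash\mathcal D(\sigma)$ whenever $R\Vdash\mathcal C(\sigma)$; composition $(G\circ F)(\sigma,R)=G(\sigma,F(\sigma,R))$, identity $(\sigma,R)\mapsto R$. -}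

module Defs where

open import Data.Nat using (ℕ; zero; suc; _≤_; _*_)
open import Data.Fin using (Fin)
open import Data.Fin.Properties using (*↔×)
open import Data.Bool using (Bool; T; _∧_)
open import Data.Bool.Properties using (T-∧)
open import Data.List using (List; map; _++_)
open import Data.List.Relation.Unary.All as All using (All)
open import Data.List.Relation.Unary.All.Properties using (map⁺; map⁻; ++⁺; ++⁻)
open import Data.Product using (Σ; ∃; _×_; _,_; proj₁; proj₂)
open import Data.Product.Function.NonDependent.Propositional using (_×-↔_)
open import Function using (_∘_; _↔_; Equivalence)
open import Function.Properties.Inverse using (↔-trans; ↔-sym)
open import Relation.Binary.PropositionalEquality using (_≡_)

Finite : Set → Set
Finite A = Σ ℕ λ n → A ↔ Fin n

Alphabet : Set → Set
Alphabet A = Finite A × A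

finite-× : {A B : Set} → Finite A → Finite B → Finite (A × B)
finite-× (m , f) (n , g) = m * n , ↔-trans (f ×-↔ g) (↔-sym *↔×)

Word : Set → Set
Word A = ℕ → A

zipW : {A B : Set} → Word A → Word B → Word (A × B)
zipW σ R n = σ n , R n

record Mealy (I O : Set) : Set₁ where
  field
    State  : Set
    finite : Finite State
    q₀     : State
    ∂      : State → I → State × O

module _ {I O : Set} (M : Mealy I O) where
  open Mealy M
  mealyRun : Word I → ℕ → State
  mealyRun w zero    = q₀
  mealyRun w (suc n) = proj₁ (∂ (mealyRun w n) (w n))

  mealyFun : Word I → Word O
  mealyFun w n = proj₂ (∂ (mealyRun w n) (w n))

FiniteStateSync : {I O : Set} → (Word I → Word O) → Set₁
FiniteStateSync {I} {O} F =
  Σ (Mealy I O) λ M → ∀ w n → F w n ≡ mealyFun M w n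

-- ω-regular sets of sequences over a finite set Q, via (nondeterministic,
-- generalized) Büchi automata reading Q.

record GBA (Q : Set) : Set₁ where
  field
    St     : Set
    finite : Finite St
    init   : St → Bool
    trans  : St → Q → St → Bool
    acc    : List (St → Bool)

InfOften : {S : Set} → (S → Bool) → (ℕ → S) → Set
InfOften F r = ∀ n → ∃ λ m → n ≤ m × T (F (r m))

Accepted : {Q : Set} → GBA Q → Word Q → Set
Accepted g w =
  ∃ λ (r : ℕ → St) → T (init (r 0))
    × (∀ k → T (trans (r k) (w k) (r (suc k))))
    × All (λ F → InfOften F r) acc
  where open GBA g

IsωRegular : {Q : Set} → (Word Q → Set) → Set₁
IsωRegular {Q} P = Σ (GBA Q) λ g → ∀ w → (P w → Accepted g w) × (Accepted g w → P w)

record Omega (Q : Set) : Set₁ where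
  field
    accepts : Word Q → Set
    regular : IsωRegular accepts

Ω-pre : {Q Q' : Set} → (Q' → Q) → Omega Q → Omega Q'
Ω-pre h Ω = record
  { accepts = λ s → accepts (h ∘ s)
  ; regular = g' , λ w → proj₁ (proj₂ reg (h ∘ w)) , proj₂ (proj₂ reg (h ∘ w)) }
  where
  open Omega Ω
  reg = regular
  g = proj₁ reg
  open GBA g
  g' = record { St = St ; finite = finite ; init = init
              ; trans = λ s q t → trans s (h q) t ; acc = acc }

Ω-× : {Q₁ Q₂ : Set} → Omega Q₁ → Omega Q₂ → Omega (Q₁ × Q₂)
Ω-× {Q₁} {Q₂} Ω₁ Ω₂ = record
  { accepts = λ s → Omega.accepts Ω₁ (proj₁ ∘ s) × Omega.accepts Ω₂ (proj₂ ∘ s)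
  ; regular = g , λ w → to w , from w }
  where
  g₁ = proj₁ (Omega.regular Ω₁)
  g₂ = proj₁ (Omega.regular Ω₂)
  module G₁ = GBA g₁
  module G₂ = GBA g₂
  g : GBA (Q₁ × Q₂)
  g = record
    { St = G₁.St × G₂.St
    ; finite = finite-× G₁.finite G₂.finite
    ; init = λ s → G₁.init (proj₁ s) ∧ G₂.init (proj₂ s)
    ; trans = λ s q t → G₁.trans (proj₁ s) (proj₁ q) (proj₁ t) ∧ G₂.trans (proj₂ s) (proj₂ q) (proj₂ t)
    ; acc = map (λ F → F ∘ proj₁) G₁.acc ++ map (λ F → F ∘ proj₂) G₂.acc }
  to : ∀ w → Omega.accepts Ω₁ (proj₁ ∘ w) × Omega.accepts Ω₂ (proj₂ ∘ w) → Accepted g w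
  to w (a₁ , a₂) with proj₁ (proj₂ (Omega.regular Ω₁) (proj₁ ∘ w)) a₁
                   | proj₁ (proj₂ (Omega.regular Ω₂) (proj₂ ∘ w)) a₂
  ... | r₁ , i₁ , t₁ , c₁ | r₂ , i₂ , t₂ , c₂ =
    (λ n → r₁ n , r₂ n)
    , Equivalence.from T-∧ (i₁ , i₂)
    , (λ k → Equivalence.from T-∧ (t₁ k , t₂ k))
    , ++⁺ (map⁺ c₁) (map⁺ c₂)
  from : ∀ w → Accepted g w → Omega.accepts Ω₁ (proj₁ ∘ w) × Omega.accepts Ω₂ (proj₂ ∘ w)
  from w (r , i , t , c) with ++⁻ (map (λ F → F ∘ proj₁) G₁.acc) c
  ... | c₁ , c₂ =
    proj₂ (proj₂ (Omega.regular Ω₁) (proj₁ ∘ w))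
      ( proj₁ ∘ r , proj₁ (Equivalence.to T-∧ i)
      , (λ k → proj₁ (Equivalence.to T-∧ (t k))) , map⁻ c₁ )
    , proj₂ (proj₂ (Omega.regular Ω₂) (proj₂ ∘ w))
      ( proj₂ ∘ r , proj₂ (Equivalence.to T-∧ i)
      , (λ k → proj₂ (Equivalence.to T-∧ (t k))) , map⁻ c₂ )

record UAut (Γ : Set) : Set₁ where
  field
    Q      : Set
    Qfin   : Finite Q
    q₀     : Q
    Mv     : Set
    Mvfin  : Finite Mv
    Mvne   : Mv
    ∂      : Q → Γ → Mv → Q
    Ω      : Omega Q

module _ {Γ : Set} (A : UAut Γ) where
  open UAut A
  stateSeq : Word Γ → Word Mv → ℕ → Q
  stateSeq σ R zero    = q₀
  stateSeq σ R (suc k) = ∂ (stateSeq σ R k) (σ k) (R k)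

_⊩_at_ : {Γ : Set} → (A : UAut Γ) → Word (UAut.Mv A) → Word Γ → Set
_⊩_at_ A R σ = Omega.accepts (UAut.Ω A) (stateSeq A σ R)
-- (read:  A ⊩ R at σ  means  R ⊩ A(σ))

_×ᵁ_ : {Γ : Set} → UAut Γ → UAut Γ → UAut Γ
A ×ᵁ B = record
  { Q = A.Q × B.Q ; Qfin = finite-× A.Qfin B.Qfin ; q₀ = A.q₀ , B.q₀
  ; Mv = A.Mv × B.Mv ; Mvfin = finite-× A.Mvfin B.Mvfin ; Mvne = A.Mvne , B.Mvne
  ; ∂ = λ q a m → A.∂ (proj₁ q) a (proj₁ m) , B.∂ (proj₂ q) a (proj₂ m)
  ; Ω = Ω-× A.Ω B.Ω }
  where
  module A = UAut A
  module B = UAut B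

_[_] : {Sg Γ : Set} → UAut Γ → Mealy Sg Γ → UAut Sg
A [ M ] = record
  { Q = A.Q × M.State ; Qfin = finite-× A.Qfin M.finite ; q₀ = A.q₀ , M.q₀
  ; Mv = A.Mv ; Mvfin = A.Mvfin ; Mvne = A.Mvne
  ; ∂ = λ q a m → A.∂ (proj₁ q) (proj₂ (M.∂ (proj₂ q) a)) m , proj₁ (M.∂ (proj₂ q) a)
  ; Ω = Ω-pre proj₁ A.Ω }
  where
  module A = UAut A
  module M = Mealy M

record Hom {Sg : Set} (C D : UAut Sg) : Set₁ where
  field
    fun   : Word (Sg × UAut.Mv C) → Word (UAut.Mv D)
    fsync : FiniteStateSync fun
    pres  : ∀ (σ : Word Sg) (R : Word (UAut.Mv C)) →
            C ⊩ R at σ → D ⊩ fun (zipW σ R) at σ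

compFun : {Sg X Y Z : Set} → (Word (Sg × Y) → Word Z) → (Word (Sg × X) → Word Y)
        → Word (Sg × X) → Word Z
compFun G F w = G (zipW (proj₁ ∘ w) (F w))

idFun : {Sg X : Set} → Word (Sg × X) → Word X
idFun w = proj₂ ∘ w

-- equality of morphisms = equality of the underlying functions (pointwise)
_≈F_ : {I O : Set} → (Word I → Word O) → (Word I → Word O) → Set
F ≈F G = ∀ w n → F w n ≡ G w n

Iso : {Sg : Set} → UAut Sg → UAut Sg → Set₁
Iso C D = Σ (Hom C D) λ f → Σ (Hom D C) λ g →
    (compFun (Hom.fun g) (Hom.fun f) ≈F idFun)
  × (compFun (Hom.fun f) (Hom.fun g) ≈F idFun)

-- Both automata read the same letters, take the same moves and share the single Mealy
-- machine; the only difference is that in A[M] × B[M] the machine is run twice.  The two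
-- copies start in the same state and see the same input, so they never diverge, and the
-- state sequences of the two automata correspond letter by letter.  Hence the identity on
-- moves is a morphism in both directions, and the two composites are the identity.
module Submission where

open import Defs
open import Data.Nat using (zero; suc)
open import Data.Unit using (⊤; tt)
open import Data.Fin.Properties using (1↔⊤)
open import Data.Bool using (T)
open import Data.Product using (_×_; _,_; proj₁; proj₂)
open import Function using (_∘_; _⇔_; mk⇔; Equivalence)
open import Function.Properties.Inverse using (↔-sym)
open import Relation.Binary.PropositionalEquality using (_≗_; refl; sym; cong; subst)

idMealy : {I O : Set} → Mealy (I × O) O
idMealy = record
  { State = ⊤ ; finite = 1 , ↔-sym 1↔⊤ ; q₀ = tt ; ∂ = λ _ x → tt , proj₂ x }

idFun-finiteStateSync : {I O : Set} → FiniteStateSync (idFun {I} {O})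
idFun-finiteStateSync = idMealy , λ _ _ → refl

accepts-resp-≗ : {Q : Set} (Ω : Omega Q) {w w′ : Word Q} →
  w ≗ w′ → Omega.accepts Ω w → Omega.accepts Ω w′
accepts-resp-≗ Ω {w} {w′} w≗w′ a with proj₁ (proj₂ (Omega.regular Ω) w) a
... | r , r-init , r-trans , r-acc =
  proj₂ (proj₂ (Omega.regular Ω) w′) (r , r-init , r-trans′ , r-acc)
  where
  open GBA (proj₁ (Omega.regular Ω))
  r-trans′ : ∀ k → T (trans (r k) (w′ k) (r (suc k)))
  r-trans′ k = subst (λ q → T (trans (r k) q (r (suc k)))) (w≗w′ k) (r-trans k)

module _ {Sg Γ : Set} (A B : UAut Γ) (M : Mealy Sg Γ) where

  separate shared : UAut Sg
  separate = (A [ M ]) ×ᵁ (B [ M ])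
  shared   = (A ×ᵁ B) [ M ]

  duplicateMealyState : UAut.Q shared → UAut.Q separate
  duplicateMealyState s = (proj₁ (proj₁ s) , proj₂ s) , (proj₂ (proj₁ s) , proj₂ s)

  stateSeq-separate : ∀ σ R →
    stateSeq separate σ R ≗ duplicateMealyState ∘ stateSeq shared σ R
  stateSeq-separate σ R zero    = refl
  stateSeq-separate σ R (suc k) =
    cong (λ q → UAut.∂ separate q (σ k) (R k)) (stateSeq-separate σ R k)

  separate⇔shared : ∀ σ R → (separate ⊩ R at σ) ⇔ (shared ⊩ R at σ)
  separate⇔shared σ R = mk⇔
    (λ (a , b) → accepts-resp-≗ (UAut.Ω A) projA a
               , accepts-resp-≗ (UAut.Ω B) projB b)
    (λ (a , b) → accepts-resp-≗ (UAut.Ω A) (sym ∘ projA) a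
               , accepts-resp-≗ (UAut.Ω B) (sym ∘ projB) b)
    where
    projA : proj₁ ∘ proj₁ ∘ stateSeq separate σ R ≗ proj₁ ∘ proj₁ ∘ stateSeq shared σ R
    projA = cong (proj₁ ∘ proj₁) ∘ stateSeq-separate σ R
    projB : proj₁ ∘ proj₂ ∘ stateSeq separate σ R ≗ proj₂ ∘ proj₁ ∘ stateSeq shared σ R
    projB = cong (proj₁ ∘ proj₂) ∘ stateSeq-separate σ R

  separate⇒shared : Hom separate shared
  separate⇒shared = record
    { fun = idFun ; fsync = idFun-finiteStateSync
    ; pres = λ σ R → Equivalence.to (separate⇔shared σ R) }

  shared⇒separate : Hom shared separate
  shared⇒separate = record
    { fun = idFun ; fsync = idFun-finiteStateSync
    ; pres = λ σ R → Equivalence.from (separate⇔shared σ R) }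

proposition6p4 : {Sg Γ : Set} → Alphabet Sg → Alphabet Γ →
    (A B : UAut Γ) (M : Mealy Sg Γ) →
    Iso ((A [ M ]) ×ᵁ (B [ M ])) ((A ×ᵁ B) [ M ])
proposition6p4 _ _ A B M =
  separate⇒shared A B M , shared⇒separate A B M , (λ _ _ → refl) , (λ _ _ → refl)
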